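{- Let $H=(\mathcal{V},\mathcal{E})$ be a hypergraph, $t$ a representative function of $H$ with image $R$, and $C:R\to\mathbb{Z}^+$ a proper vertex colouring of the co-occurrence graph $G_{R,t}$. Then the colouring of $\mathcal{V}$ that agrees with $C$ on $R$ and gives colour $0$ to vertices outside $R$ is a conflict-free colouring of $H$. Moreover, $\chi_{cf}(H)\le\chi_{min}$.
   Context: A hypergraph $H=(\mathcal{V},\mathcal{E})$ has finite vertex set $\mathcal{V}$ and a set $\mathcal{E}$ of non-empty subsets of $\mathcal{V}$. A conflict-free colouring of $H$ is a function $C:\mathcal{V}\to\{0,1,2,\dots\}$ such that for every $E\in\mathcal{E}$ there is $j\ge1$ with $|E\cap C^{ -1}(j)|=1$; $\chi_{cf}(H)$ is the minimum number of non-zero colours used by such a colouring. A representative function is a map $t:\mathcal{E}\to\mathcal{V}$ with $t(E)\in E$; $R=t(\mathcal{E})$. The co-occurrence graph $G_{R,t}$ has vertex set $R$, with distinct $u,v$ adjacent iff some $E\in\mathcal{E}$ has $u,v\in E$ and $t(E)\in\{u,v\}$. $\chi_{min}=\min_{R,t}\chi(G_{R,t})$ over all representative functions $t$. -}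

module Defs where

open import Data.Nat using (ℕ; _≤_; _≟_)
open import Data.Fin using (Fin)
open import Data.Fin.Subset using (Subset; _∈_; Nonempty)
open import Data.Fin.Properties using (any?) renaming (_≟_ to _≟ᶠ_)
open import Data.List using (List; length; map; filter; deduplicate)
open import Data.List.Base using () renaming (allFin to allFinL)
open import Data.Product using (Σ; ∃; _×_; _,_)
open import Data.Sum using (_⊎_)
open import Relation.Nullary using (¬_; Dec; yes; no)
open import Relation.Nullary.Decidable using (¬?)
open import Relation.Binary.PropositionalEquality using (_≡_; _≢_)
open import Function.Definitions using (Injective)

-- A hypergraph on the finite vertex set Fin n with a SET of non-empty
-- hyperedges, given as an injective (duplicate-free) family indexed by Fin m.
record Hypergraph : Set where
  field
    n        : ℕ
    m        : ℕ
    edge     : Fin m → Subset n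
    nonempty : (e : Fin m) → Nonempty (edge e)
    distinct : Injective _≡_ _≡_ edge

open Hypergraph public

-- colourings of the vertices (colour 0 = "uncoloured")
Colouring : Hypergraph → Set
Colouring H = Fin (n H) → ℕ

nonzero? : (k : ℕ) → Dec (¬ (k ≡ 0))
nonzero? k = ¬? (k ≟ 0)

numColours : (H : Hypergraph) → Colouring H → ℕ
numColours H C = length (deduplicate _≟_ (filter nonzero? (map C (allFinL (n H)))))

ConflictFree : (H : Hypergraph) → Colouring H → Set
ConflictFree H C = (e : Fin (m H)) → Σ ℕ λ j → (1 ≤ j) ×
  (Σ (Fin (n H)) λ v → (v ∈ edge H e × C v ≡ j) ×
     ((w : Fin (n H)) → w ∈ edge H e → C w ≡ j → w ≡ v))

IsChiCF : Hypergraph → ℕ → Set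
IsChiCF H k = (Σ (Colouring H) λ C → ConflictFree H C × numColours H C ≡ k) ×
  ((C : Colouring H) → ConflictFree H C → k ≤ numColours H C)

Representative : (H : Hypergraph) → (Fin (m H) → Fin (n H)) → Set
Representative H t = (e : Fin (m H)) → t e ∈ edge H e

InR : (H : Hypergraph) → (Fin (m H) → Fin (n H)) → Fin (n H) → Set
InR H t v = ∃ λ e → t e ≡ v

InR? : (H : Hypergraph) → (t : Fin (m H) → Fin (n H)) → (v : Fin (n H)) → Dec (InR H t v)
InR? H t v = any? (λ e → t e ≟ᶠ v)

Adj : (H : Hypergraph) → (Fin (m H) → Fin (n H)) → Fin (n H) → Fin (n H) → Set
Adj H t u v = InR H t u × InR H t v × u ≢ v ×
  (Σ (Fin (m H)) λ e → u ∈ edge H e × v ∈ edge H e × (t e ≡ u ⊎ t e ≡ v))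

-- A colouring C : R → ℤ⁺ of G_{R,t}, represented by a function on all vertices
-- whose values outside R are ignored.
ProperColouring : (H : Hypergraph) → (Fin (m H) → Fin (n H)) → (Fin (n H) → ℕ) → Set
ProperColouring H t C = ((v : Fin (n H)) → InR H t v → 1 ≤ C v) ×
  ((u v : Fin (n H)) → Adj H t u v → C u ≢ C v)

numColoursR : (H : Hypergraph) → (Fin (m H) → Fin (n H)) → (Fin (n H) → ℕ) → ℕ
numColoursR H t C = length (deduplicate _≟_ (map C (filter (InR? H t) (allFinL (n H)))))

IsChromatic : (H : Hypergraph) → (Fin (m H) → Fin (n H)) → ℕ → Set
IsChromatic H t k = (Σ (Fin (n H) → ℕ) λ C → ProperColouring H t C × numColoursR H t C ≡ k) ×
  ((C : Fin (n H) → ℕ) → ProperColouring H t C → k ≤ numColoursR H t C)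

IsChiMin : Hypergraph → ℕ → Set
IsChiMin H k = (Σ (Fin (m H) → Fin (n H)) λ t → Representative H t × IsChromatic H t k) ×
  ((t : Fin (m H) → Fin (n H)) → Representative H t → (k' : ℕ) → IsChromatic H t k' → k ≤ k')

extend : (H : Hypergraph) → (t : Fin (m H) → Fin (n H)) → (Fin (n H) → ℕ) → Colouring H
extend H t C v with InR? H t v
... | yes _ = C v
... | no  _ = 0

module Submission where

-- For an edge E the representative t(E) receives the positive
-- colour C(t(E)), and it is the only vertex of E with that colour: a vertex
-- outside R has colour 0, and a vertex w ≠ t(E) of E inside R is adjacent to
-- t(E) in G_{R,t} (witnessed by E itself), so properness separates them.
--
-- For the bound, the extension of an optimal colouring for an optimal t is
-- conflict-free, and it uses exactly the colours C uses on R: filtering the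
-- non-zero values of the extension gives the same list as mapping C over the
-- vertices of R.  Hence χ_cf(H) ≤ #colours(extension) = χ(G_{R,t}) = χ_min.

open import Defs
open import Data.Nat using (ℕ; _≤_; _≟_)
open import Data.Nat.Properties using (≤-trans; ≤-reflexive; m<n⇒n≢0)
open import Data.Fin using (Fin)
open import Data.Fin.Subset using (_∈_)
open import Data.Fin.Properties using () renaming (_≟_ to _≟ᶠ_)
open import Data.Product using (_×_; _,_)
open import Data.Sum using (inj₂)
open import Data.List using (List; []; _∷_; map; filter; length; deduplicate)
open import Data.List.Base using () renaming (allFin to allFinL)
open import Data.List.Properties using (filter-accept; filter-reject)
open import Data.Empty using (⊥-elim)
open import Relation.Nullary using (Dec; yes; no; ¬_)
open import Relation.Binary.PropositionalEquality
  using (_≡_; _≢_; refl; sym; trans; cong; subst; module ≡-Reasoning)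

extend-inR : (H : Hypergraph) (t : Fin (m H) → Fin (n H)) (C : Fin (n H) → ℕ)
  (v : Fin (n H)) → InR H t v → extend H t C v ≡ C v
extend-inR H t C v v∈R with InR? H t v
... | yes _   = refl
... | no v∉R = ⊥-elim (v∉R v∈R)

extend-outR : (H : Hypergraph) (t : Fin (m H) → Fin (n H)) (C : Fin (n H) → ℕ)
  (v : Fin (n H)) → ¬ InR H t v → extend H t C v ≡ 0
extend-outR H t C v v∉R with InR? H t v
... | yes v∈R = ⊥-elim (v∉R v∈R)
... | no _    = refl

extend-positive⇒inR : (H : Hypergraph) (t : Fin (m H) → Fin (n H))
  (C : Fin (n H) → ℕ) (v : Fin (n H)) → 1 ≤ extend H t C v → InR H t v
extend-positive⇒inR H t C v pos with InR? H t v | pos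
... | yes v∈R | _ = v∈R
... | no _    | ()

adjacent-to-representative : (H : Hypergraph) (t : Fin (m H) → Fin (n H)) →
  Representative H t → (e : Fin (m H)) (w : Fin (n H)) →
  InR H t w → w ∈ edge H e → w ≢ t e → Adj H t w (t e)
adjacent-to-representative H t rep e w w∈R w∈e w≢te =
  w∈R , (e , refl) , w≢te , e , w∈e , rep e , inj₂ refl

extension-conflictFree : (H : Hypergraph) (t : Fin (m H) → Fin (n H)) →
  Representative H t → (C : Fin (n H) → ℕ) → ProperColouring H t C →
  ConflictFree H (extend H t C)
extension-conflictFree H t rep C (positive , proper) e =
  C (t e) , positive (t e) te∈R , t e ,
  (rep e , extend-inR H t C (t e) te∈R) , unique
  where
  te∈R : InR H t (t e)
  te∈R = e , refl

  unique : (w : Fin (n H)) → w ∈ edge H e → extend H t C w ≡ C (t e) → w ≡ t e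
  unique w w∈e same with w ≟ᶠ t e
  ... | yes w≡te = w≡te
  ... | no w≢te  = ⊥-elim (proper w (t e)
          (adjacent-to-representative H t rep e w w∈R w∈e w≢te)
          (trans (sym (extend-inR H t C w w∈R)) same))
    where
    w∈R : InR H t w
    w∈R = extend-positive⇒inR H t C w
            (subst (1 ≤_) (sym same) (positive (t e) te∈R))

nonzero-colours-of-extension : (H : Hypergraph) (t : Fin (m H) → Fin (n H))
  (C : Fin (n H) → ℕ) → ((v : Fin (n H)) → InR H t v → 1 ≤ C v) →
  (vs : List (Fin (n H))) →
  filter nonzero? (map (extend H t C) vs) ≡ map C (filter (InR? H t) vs)
nonzero-colours-of-extension H t C positive [] = refl
nonzero-colours-of-extension H t C positive (v ∷ vs) = cons (InR? H t v)
  where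
  open ≡-Reasoning
  rest : List ℕ
  rest = map (extend H t C) vs

  IH : filter nonzero? rest ≡ map C (filter (InR? H t) vs)
  IH = nonzero-colours-of-extension H t C positive vs

  cons : Dec (InR H t v) →
    filter nonzero? (extend H t C v ∷ rest) ≡ map C (filter (InR? H t) (v ∷ vs))
  cons (yes v∈R) = begin
    filter nonzero? (extend H t C v ∷ rest)
      ≡⟨ cong (λ c → filter nonzero? (c ∷ rest)) (extend-inR H t C v v∈R) ⟩
    filter nonzero? (C v ∷ rest)
      ≡⟨ filter-accept nonzero? {xs = rest} (m<n⇒n≢0 (positive v v∈R)) ⟩
    C v ∷ filter nonzero? rest
      ≡⟨ cong (C v ∷_) IH ⟩
    map C (v ∷ filter (InR? H t) vs)
      ≡⟨ cong (map C) (sym (filter-accept (InR? H t) v∈R)) ⟩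
    map C (filter (InR? H t) (v ∷ vs)) ∎
  cons (no v∉R) = begin
    filter nonzero? (extend H t C v ∷ rest)
      ≡⟨ cong (λ c → filter nonzero? (c ∷ rest)) (extend-outR H t C v v∉R) ⟩
    filter nonzero? (0 ∷ rest)
      ≡⟨ filter-reject nonzero? {xs = rest} (λ 0≢0 → 0≢0 refl) ⟩
    filter nonzero? rest
      ≡⟨ IH ⟩
    map C (filter (InR? H t) vs)
      ≡⟨ cong (map C) (sym (filter-reject (InR? H t) v∉R)) ⟩
    map C (filter (InR? H t) (v ∷ vs)) ∎

numColours-extend : (H : Hypergraph) (t : Fin (m H) → Fin (n H))
  (C : Fin (n H) → ℕ) → ProperColouring H t C →
  numColours H (extend H t C) ≡ numColoursR H t C
numColours-extend H t C (positive , _) =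
  cong (λ cs → length (deduplicate _≟_ cs))
    (nonzero-colours-of-extension H t C positive (allFinL (n H)))

chiCF≤chiMin : (H : Hypergraph) (a b : ℕ) → IsChiCF H a → IsChiMin H b → a ≤ b
chiCF≤chiMin H a b (_ , a-minimal) ((t , rep , (C , proper , C-uses-b) , _) , _) =
  ≤-trans (a-minimal (extend H t C) (extension-conflictFree H t rep C proper))
    (≤-reflexive (trans (numColours-extend H t C proper) C-uses-b))

lemma1 : (H : Hypergraph) (t : Fin (m H) → Fin (n H)) → Representative H t →
    (C : Fin (n H) → ℕ) → ProperColouring H t C →
    ConflictFree H (extend H t C) ×
    ((a b : ℕ) → IsChiCF H a → IsChiMin H b → a ≤ b)
lemma1 H t rep C proper =
  extension-conflictFree H t rep C proper , chiCF≤chiMin H
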